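{- Let $i>0$, $m\geq 0$ and $m'\geq 0$ be integers. Let $h(t)\in S_{m+1}$ and $h'(t)\in S_{m'+1}$. If $g^{(m,i)}(h(t))\geq 0$ and $g^{(m',i)}(h'(t))\geq 0$ componentwise, then $g^{(m+m'+1,i)}(h(t)h'(t))\geq 0$ componentwise.
   Context: For an integer $N\geq 0$, $S_N$ is the $\mathbb{Z}$-module of polynomials $h(t)=\sum_{j=0}^N h_jt^j$ with integer coefficients satisfying $h_j=h_{N-j}$ for all $j$ (symmetric of degree at most $N$ with axis of symmetry at $\frac N2$). For integers $d\geq 0$ and $i>0$, let $q\geq 0$, $1\leq r\leq i$ be the unique integers with $d+1=qi+r$, and define $P_{d,i}(t)=(1+t+\cdots+t^i)^q(1+t+\cdots+t^r)$; also set $P_{ -1,i}(t)=1$. Define the ordered basis $B_{d,i}=(P_{d,i}(t),\,tP_{d-2,i}(t),\,t^2P_{d-4,i}(t),\dots,t^{\lfloor\frac{d+1}{2}\rfloor}P_{d-2\lfloor\frac{d+1}{2}\rfloor,i}(t))$ of the rational span of $S_{d+1}$. For $h(t)\in S_{d+1}$, $g^{(d,i)}(h(t))=(g_0,\dots,g_{\lfloor\frac{d+1}{2}\rfloor})$ is the vector of coefficients of $h(t)$ in the basis $B_{d,i}$, i.e. $h(t)=\sum_k g_kt^kP_{d-2k,i}(t)$. -}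

module Defs where

open import Data.Nat as ℕ using (ℕ; zero; suc; _∸_; _/_)
open import Data.Integer as ℤ using (ℤ; +_; 0ℤ; 1ℤ)
open import Data.List using (List; replicate; _++_)
open List
open import Data.Vec using (Vec; lookup; []; _∷_)
open import Data.Vec.Relation.Unary.All using (All)
open import Data.Fin using (Fin; opposite; toℕ)
open import Data.Product using (Σ; _×_)
open import Relation.Binary.PropositionalEquality using (_≡_)

-- Polynomials with integer coefficients, as coefficient lists
-- (constant term first).
Poly : Set
Poly = List ℤ

coeff : Poly → ℕ → ℤ
coeff []       _       = 0ℤ
coeff (a ∷ p)  zero    = a
coeff (a ∷ p)  (suc j) = coeff p j

_≈ₚ_ : Poly → Poly → Set
p ≈ₚ q = ∀ j → coeff p j ≡ coeff q j

infixl 6 _+ₚ_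
infixl 7 _*ₚ_ _·ₚ_

_+ₚ_ : Poly → Poly → Poly
[]      +ₚ q       = q
(a ∷ p) +ₚ []      = a ∷ p
(a ∷ p) +ₚ (b ∷ q) = (a ℤ.+ b) ∷ (p +ₚ q)

_·ₚ_ : ℤ → Poly → Poly
c ·ₚ []      = []
c ·ₚ (a ∷ p) = (c ℤ.* a) ∷ (c ·ₚ p)

_*ₚ_ : Poly → Poly → Poly
[]      *ₚ q = []
(a ∷ p) *ₚ q = (a ·ₚ q) +ₚ (0ℤ ∷ (p *ₚ q))

shift : ℕ → Poly → Poly
shift k p = replicate k 0ℤ ++ p

onePoly : Poly
onePoly = 1ℤ ∷ []

_^ₚ_ : Poly → ℕ → Poly
p ^ₚ zero  = onePoly
p ^ₚ suc n = p *ₚ (p ^ₚ n)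

geom : ℕ → Poly
geom i = replicate (suc i) 1ℤ

-- Pshift n i = P_{n-1,i}(t), i.e. argument n = d+1 ≥ 0.
-- For n = 0 this is P_{-1,i} = 1.  For n ≥ 1 and i > 0:
-- n = q i + r with 1 ≤ r ≤ i, q = (n-1)/i, r = n - q i.
-- (For i = 0, which is excluded by the hypotheses, a junk value 1 is used.)
Pshift : ℕ → ℕ → Poly
Pshift zero    i       = onePoly
Pshift (suc n) zero    = onePoly
Pshift (suc n) (suc j) =
  let q = n / suc j
      r = suc n ∸ q ℕ.* suc j
  in (geom (suc j) ^ₚ q) *ₚ geom r

-- number of basis elements of B_{d,i} minus one: ⌊(d+1)/2⌋
half : ℕ → ℕ
half d = suc d / 2

-- Σ_{k=0}^{n} g_k t^k P_{d-2k,i}(t), where the polynomial P_{d-2k,i}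
-- is Pshift (d + 1 - 2k) i.
expand : (d i : ℕ) → ∀ {n} → (k : ℕ) → Vec ℤ n → Poly
expand d i k []       = []
expand d i k (g ∷ gs) =
  (g ·ₚ shift k (Pshift (suc d ∸ 2 ℕ.* k) i)) +ₚ expand d i (suc k) gs

combB : (d i : ℕ) → Vec ℤ (suc (half d)) → Poly
combB d i g = expand d i 0 g

-- g is the coefficient vector g^{(d,i)}(h) of h in the basis B_{d,i}
IsG : (d i : ℕ) → Poly → Vec ℤ (suc (half d)) → Set
IsG d i h g = combB d i g ≈ₚ h

-- g^{(d,i)}(h) ≥ 0 componentwise (the coefficient vector exists and is
-- unique for h ∈ S_{d+1} since B_{d,i} is a basis)
GNonneg : (d i : ℕ) → Poly → Set
GNonneg d i h = Σ (Vec ℤ (suc (half d))) λ g → All (ℤ._≤_ 0ℤ) g × IsG d i h g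

-- h ∈ S_N, for h given by its N+1 coefficients h_0..h_N
Symmetric : ∀ {N} → Vec ℤ (suc N) → Set
Symmetric {N} h = ∀ (j : Fin (suc N)) → lookup h j ≡ lookup h (opposite j)

-- A polynomial has nonnegative coordinates in B_{d,i} exactly when it is a
-- nonnegative integer combination of the t^j P_{d-2j,i}.  Such combinations
-- are closed under sums and under multiplication by t (which raises d by 2),
-- so closure under products reduces to P_{a-1,i} P_{b-1,i} being a
-- nonnegative combination of the t^j P_{a+b-1-2j,i}.  With G = 1 + ⋯ + tⁱ we
-- have G P_{n,i} = P_{n+i,i} and P_{a-1,i} = Gᵠ (1 + ⋯ + tʳ) for a = q i + r,
-- 0 ≤ r < i, which leaves the products (1 + ⋯ + tʳ)(1 + ⋯ + t^r′) with
-- r, r′ < i.  If r + r′ ≤ i, splitting off 1 + ⋯ + t^(r+r′) leaves t times a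
-- product of the same kind.  Otherwise r = c+x+1, r′ = c+y+1, i = c+x+y+2,
-- and the product is G (1 + ⋯ + t^c) + t^(c+1) (1 + ⋯ + t^x)(1 + ⋯ + t^y),
-- where x + y + 2 ≤ i.

module Submission where

open import Defs
open import Data.Nat
  using (ℕ; zero; suc; _+_; _*_; _∸_; _<_; _≤_; _/_; _%_; z≤n; s≤s; s≤s⁻¹; _≤?_)
import Data.Nat.Properties as ℕₚ
open import Data.Nat.DivMod
  using (m≡m%n+[m/n]*n; m%n<n; m<n⇒m/n≡0; m/n≡1+[m∸n]/n; m*n/n≡m; m/n*n≤m; /-monoˡ-≤)
open import Data.Nat.Tactic.RingSolver using (solve-∀)
open import Data.Integer as ℤ using (ℤ; +_; 0ℤ; 1ℤ; +≤+)
import Data.Integer.Properties as ℤₚ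
open import Data.List using ([]; _∷_)
open import Data.Vec as Vec using (Vec; toList)
open import Data.Vec.Relation.Unary.All as All using (All; []; _∷_)
open import Data.Product using (∃-syntax; _×_; _,_)
open import Function.Base using (_∘_)
open import Relation.Nullary using (yes; no)
open import Relation.Binary.PropositionalEquality
  using (_≡_; refl; sym; trans; cong; cong₂; subst)
open import Relation.Binary.Bundles using (Setoid)
open import Relation.Binary.Structures using (IsEquivalence)
open import Algebra.Bundles using (CommutativeSemigroup)
open import Algebra.Definitions using (Congruent₂)
import Algebra.Properties.CommutativeSemigroup as CommutativeSemigroupProperties
import Relation.Binary.Reasoning.Setoid as SetoidReasoning

private
  variable
    a b : ℤ
    p p′ q q′ r : Poly
    d k m n : ℕ

-- Polynomial arithmetic

coeff-+ₚ : ∀ p q j → coeff (p +ₚ q) j ≡ coeff p j ℤ.+ coeff q j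
coeff-+ₚ []      q       j       = sym (ℤₚ.+-identityˡ _)
coeff-+ₚ (a ∷ p) []      j       = sym (ℤₚ.+-identityʳ _)
coeff-+ₚ (a ∷ p) (b ∷ q) zero    = refl
coeff-+ₚ (a ∷ p) (b ∷ q) (suc j) = coeff-+ₚ p q j

coeff-·ₚ : ∀ c p j → coeff (c ·ₚ p) j ≡ c ℤ.* coeff p j
coeff-·ₚ c []      j       = sym (ℤₚ.*-zeroʳ c)
coeff-·ₚ c (a ∷ p) zero    = refl
coeff-·ₚ c (a ∷ p) (suc j) = coeff-·ₚ c p j

infix 4 _≋_

-- _≈ₚ_ unfolds to a function type, from which Agda cannot infer the two
-- polynomials; the record keeps them visible to unification.
record _≋_ (p q : Poly) : Set where
  constructor mk≋
  field coeff≡ : p ≈ₚ q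
open _≋_

≋-refl : p ≋ p
≋-refl = mk≋ λ _ → refl

≋-sym : p ≋ q → q ≋ p
≋-sym (mk≋ e) = mk≋ λ j → sym (e j)

≋-trans : p ≋ q → q ≋ r → p ≋ r
≋-trans (mk≋ e) (mk≋ f) = mk≋ λ j → trans (e j) (f j)

≡⇒≋ : p ≡ q → p ≋ q
≡⇒≋ refl = ≋-refl

≋-isEquivalence : IsEquivalence _≋_
≋-isEquivalence = record { refl = ≋-refl ; sym = ≋-sym ; trans = ≋-trans }

≋-setoid : Setoid _ _
≋-setoid = record { isEquivalence = ≋-isEquivalence }

open SetoidReasoning ≋-setoid

∷-cong : a ≡ b → p ≋ q → a ∷ p ≋ b ∷ q
∷-cong a≡b (mk≋ e) = mk≋ λ { zero → a≡b ; (suc j) → e j }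

∷-congˡ : ∀ a → p ≋ q → a ∷ p ≋ a ∷ q
∷-congˡ a = ∷-cong refl

0∷-≋[] : p ≋ [] → 0ℤ ∷ p ≋ []
0∷-≋[] (mk≋ e) = mk≋ λ { zero → refl ; (suc j) → e j }

+ₚ-cong : Congruent₂ _≋_ _+ₚ_
+ₚ-cong {p} {p′} {q} {q′} (mk≋ e) (mk≋ f) = mk≋ λ j →
  trans (coeff-+ₚ p q j) (trans (cong₂ ℤ._+_ (e j) (f j)) (sym (coeff-+ₚ p′ q′ j)))

+ₚ-congˡ : ∀ p → q ≋ q′ → p +ₚ q ≋ p +ₚ q′
+ₚ-congˡ p = +ₚ-cong (≋-refl {p})

+ₚ-congʳ : ∀ q → p ≋ p′ → p +ₚ q ≋ p′ +ₚ q
+ₚ-congʳ q e = +ₚ-cong e (≋-refl {q})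

+ₚ-comm : ∀ p q → p +ₚ q ≋ q +ₚ p
+ₚ-comm p q = mk≋ λ j →
  trans (coeff-+ₚ p q j) (trans (ℤₚ.+-comm (coeff p j) _) (sym (coeff-+ₚ q p j)))

+ₚ-assoc : ∀ p q r → (p +ₚ q) +ₚ r ≋ p +ₚ (q +ₚ r)
+ₚ-assoc p q r = mk≋ λ j →
  trans (coeff-+ₚ (p +ₚ q) r j)
    (trans (cong (ℤ._+ coeff r j) (coeff-+ₚ p q j))
      (trans (ℤₚ.+-assoc (coeff p j) (coeff q j) (coeff r j))
        (sym (trans (coeff-+ₚ p (q +ₚ r) j) (cong (ℤ._+_ (coeff p j)) (coeff-+ₚ q r j))))))

+ₚ-identityʳ : ∀ p → p +ₚ [] ≡ p
+ₚ-identityʳ []      = refl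
+ₚ-identityʳ (a ∷ p) = refl

+ₚ-commutativeSemigroup : CommutativeSemigroup _ _
+ₚ-commutativeSemigroup = record
  { isCommutativeSemigroup = record
    { isSemigroup = record
      { isMagma = record { isEquivalence = ≋-isEquivalence ; ∙-cong = +ₚ-cong }
      ; assoc   = +ₚ-assoc
      }
    ; comm = +ₚ-comm
    }
  }

module +ₚ = CommutativeSemigroupProperties +ₚ-commutativeSemigroup

·ₚ-congˡ : ∀ c → p ≋ q → c ·ₚ p ≋ c ·ₚ q
·ₚ-congˡ {p} {q} c (mk≋ e) = mk≋ λ j →
  trans (coeff-·ₚ c p j) (trans (cong (c ℤ.*_) (e j)) (sym (coeff-·ₚ c q j)))

·ₚ-distribʳ-+ : ∀ a b p → (a ℤ.+ b) ·ₚ p ≋ a ·ₚ p +ₚ b ·ₚ p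
·ₚ-distribʳ-+ a b p = mk≋ λ j →
  trans (coeff-·ₚ (a ℤ.+ b) p j)
    (trans (ℤₚ.*-distribʳ-+ (coeff p j) a b)
      (sym (trans (coeff-+ₚ (a ·ₚ p) (b ·ₚ p) j)
                  (cong₂ ℤ._+_ (coeff-·ₚ a p j) (coeff-·ₚ b p j)))))

·ₚ-distribˡ-+ₚ : ∀ c p q → c ·ₚ (p +ₚ q) ≋ c ·ₚ p +ₚ c ·ₚ q
·ₚ-distribˡ-+ₚ c p q = mk≋ λ j →
  trans (coeff-·ₚ c (p +ₚ q) j)
    (trans (cong (c ℤ.*_) (coeff-+ₚ p q j))
      (trans (ℤₚ.*-distribˡ-+ c (coeff p j) (coeff q j))
        (sym (trans (coeff-+ₚ (c ·ₚ p) (c ·ₚ q) j)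
                    (cong₂ ℤ._+_ (coeff-·ₚ c p j) (coeff-·ₚ c q j))))))

·ₚ-assoc : ∀ a b p → a ·ₚ (b ·ₚ p) ≋ (a ℤ.* b) ·ₚ p
·ₚ-assoc a b p = mk≋ λ j →
  trans (coeff-·ₚ a (b ·ₚ p) j)
    (trans (cong (a ℤ.*_) (coeff-·ₚ b p j))
      (trans (sym (ℤₚ.*-assoc a b (coeff p j))) (sym (coeff-·ₚ (a ℤ.* b) p j))))

·ₚ-identityˡ : ∀ p → 1ℤ ·ₚ p ≋ p
·ₚ-identityˡ p = mk≋ λ j → trans (coeff-·ₚ 1ℤ p j) (ℤₚ.*-identityˡ (coeff p j))

·ₚ-zeroˡ : ∀ p → 0ℤ ·ₚ p ≋ []
·ₚ-zeroˡ p = mk≋ (coeff-·ₚ 0ℤ p)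

·ₚ-0∷ : ∀ c p → c ·ₚ (0ℤ ∷ p) ≋ 0ℤ ∷ c ·ₚ p
·ₚ-0∷ c p = ∷-cong (ℤₚ.*-zeroʳ c) ≋-refl

*ₚ-congˡ : ∀ p → q ≋ q′ → p *ₚ q ≋ p *ₚ q′
*ₚ-congˡ []      e = ≋-refl
*ₚ-congˡ (a ∷ p) e = +ₚ-cong (·ₚ-congˡ a e) (∷-congˡ 0ℤ (*ₚ-congˡ p e))

*ₚ-zeroʳ : ∀ p → p *ₚ [] ≋ []
*ₚ-zeroʳ []      = ≋-refl
*ₚ-zeroʳ (a ∷ p) = 0∷-≋[] (*ₚ-zeroʳ p)

*ₚ-consʳ : ∀ p a q → p *ₚ (a ∷ q) ≋ a ·ₚ p +ₚ (0ℤ ∷ p *ₚ q)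
*ₚ-consʳ []      a q = ≋-sym (0∷-≋[] ≋-refl)
*ₚ-consʳ (b ∷ p) a q = begin
  b ·ₚ (a ∷ q) +ₚ (0ℤ ∷ p *ₚ (a ∷ q))
    ≈⟨ +ₚ-congˡ (b ·ₚ (a ∷ q)) (∷-congˡ 0ℤ (*ₚ-consʳ p a q)) ⟩
  (b ℤ.* a ℤ.+ 0ℤ) ∷ (b ·ₚ q +ₚ (a ·ₚ p +ₚ (0ℤ ∷ p *ₚ q)))
    ≈⟨ ∷-cong (cong (ℤ._+ 0ℤ) (ℤₚ.*-comm b a)) (+ₚ.x∙yz≈y∙xz (b ·ₚ q) (a ·ₚ p) _) ⟩
  a ·ₚ (b ∷ p) +ₚ (0ℤ ∷ (b ∷ p) *ₚ q) ∎

*ₚ-comm : ∀ p q → p *ₚ q ≋ q *ₚ p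
*ₚ-comm []      q = ≋-sym (*ₚ-zeroʳ q)
*ₚ-comm (a ∷ p) q =
  ≋-trans (+ₚ-congˡ (a ·ₚ q) (∷-congˡ 0ℤ (*ₚ-comm p q))) (≋-sym (*ₚ-consʳ q a p))

*ₚ-congʳ : ∀ q → p ≋ p′ → p *ₚ q ≋ p′ *ₚ q
*ₚ-congʳ {p} {p′} q e = ≋-trans (*ₚ-comm p q) (≋-trans (*ₚ-congˡ q e) (*ₚ-comm q p′))

*ₚ-cong : Congruent₂ _≋_ _*ₚ_
*ₚ-cong {p} {p′} {q} e f = ≋-trans (*ₚ-congʳ q e) (*ₚ-congˡ p′ f)

*ₚ-distribˡ-+ₚ : ∀ p q r → p *ₚ (q +ₚ r) ≋ p *ₚ q +ₚ p *ₚ r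
*ₚ-distribˡ-+ₚ []      q r = ≋-refl
*ₚ-distribˡ-+ₚ (a ∷ p) q r = begin
  a ·ₚ (q +ₚ r) +ₚ (0ℤ ∷ p *ₚ (q +ₚ r))
    ≈⟨ +ₚ-cong (·ₚ-distribˡ-+ₚ a q r) (∷-congˡ 0ℤ (*ₚ-distribˡ-+ₚ p q r)) ⟩
  (a ·ₚ q +ₚ a ·ₚ r) +ₚ ((0ℤ ∷ p *ₚ q) +ₚ (0ℤ ∷ p *ₚ r))
    ≈⟨ +ₚ.interchange (a ·ₚ q) (a ·ₚ r) _ _ ⟩
  (a ∷ p) *ₚ q +ₚ (a ∷ p) *ₚ r ∎

*ₚ-distribʳ-+ₚ : ∀ p q r → (p +ₚ q) *ₚ r ≋ p *ₚ r +ₚ q *ₚ r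
*ₚ-distribʳ-+ₚ p q r = begin
  (p +ₚ q) *ₚ r       ≈⟨ *ₚ-comm (p +ₚ q) r ⟩
  r *ₚ (p +ₚ q)       ≈⟨ *ₚ-distribˡ-+ₚ r p q ⟩
  r *ₚ p +ₚ r *ₚ q    ≈⟨ +ₚ-cong (*ₚ-comm r p) (*ₚ-comm r q) ⟩
  p *ₚ r +ₚ q *ₚ r    ∎

0∷-*ₚ : ∀ p q → (0ℤ ∷ p) *ₚ q ≋ 0ℤ ∷ p *ₚ q
0∷-*ₚ p q = +ₚ-congʳ (0ℤ ∷ p *ₚ q) (·ₚ-zeroˡ q)

·ₚ-*ₚ-assoc : ∀ c p q → (c ·ₚ p) *ₚ q ≋ c ·ₚ (p *ₚ q)
·ₚ-*ₚ-assoc c []      q = ≋-refl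
·ₚ-*ₚ-assoc c (a ∷ p) q = begin
  (c ℤ.* a) ·ₚ q +ₚ (0ℤ ∷ (c ·ₚ p) *ₚ q)
    ≈⟨ +ₚ-cong (≋-sym (·ₚ-assoc c a q)) (∷-congˡ 0ℤ (·ₚ-*ₚ-assoc c p q)) ⟩
  c ·ₚ (a ·ₚ q) +ₚ (0ℤ ∷ c ·ₚ (p *ₚ q))
    ≈⟨ +ₚ-congˡ (c ·ₚ (a ·ₚ q)) (≋-sym (·ₚ-0∷ c (p *ₚ q))) ⟩
  c ·ₚ (a ·ₚ q) +ₚ c ·ₚ (0ℤ ∷ p *ₚ q)
    ≈⟨ ≋-sym (·ₚ-distribˡ-+ₚ c (a ·ₚ q) _) ⟩
  c ·ₚ ((a ∷ p) *ₚ q) ∎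

*ₚ-assoc : ∀ p q r → (p *ₚ q) *ₚ r ≋ p *ₚ (q *ₚ r)
*ₚ-assoc []      q r = ≋-refl
*ₚ-assoc (a ∷ p) q r = begin
  (a ·ₚ q +ₚ (0ℤ ∷ p *ₚ q)) *ₚ r
    ≈⟨ *ₚ-distribʳ-+ₚ (a ·ₚ q) _ r ⟩
  (a ·ₚ q) *ₚ r +ₚ (0ℤ ∷ p *ₚ q) *ₚ r
    ≈⟨ +ₚ-cong (·ₚ-*ₚ-assoc a q r) (0∷-*ₚ (p *ₚ q) r) ⟩
  a ·ₚ (q *ₚ r) +ₚ (0ℤ ∷ (p *ₚ q) *ₚ r)
    ≈⟨ +ₚ-congˡ (a ·ₚ (q *ₚ r)) (∷-congˡ 0ℤ (*ₚ-assoc p q r)) ⟩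
  a ·ₚ (q *ₚ r) +ₚ (0ℤ ∷ p *ₚ (q *ₚ r)) ∎

*ₚ-identityˡ : ∀ p → onePoly *ₚ p ≋ p
*ₚ-identityˡ p =
  ≋-trans (+ₚ-cong (·ₚ-identityˡ p) (0∷-≋[] ≋-refl)) (≡⇒≋ (+ₚ-identityʳ p))

*ₚ-identityʳ : ∀ p → p *ₚ onePoly ≋ p
*ₚ-identityʳ p = ≋-trans (*ₚ-comm p onePoly) (*ₚ-identityˡ p)

*ₚ-commutativeSemigroup : CommutativeSemigroup _ _
*ₚ-commutativeSemigroup = record
  { isCommutativeSemigroup = record
    { isSemigroup = record
      { isMagma = record { isEquivalence = ≋-isEquivalence ; ∙-cong = *ₚ-cong }
      ; assoc   = *ₚ-assoc
      }
    ; comm = *ₚ-comm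
    }
  }

module *ₚ = CommutativeSemigroupProperties *ₚ-commutativeSemigroup

shift-cong : ∀ k → p ≋ q → shift k p ≋ shift k q
shift-cong zero    e = e
shift-cong (suc k) e = ∷-congˡ 0ℤ (shift-cong k e)

shift-[] : ∀ k → shift k [] ≋ []
shift-[] zero    = ≋-refl
shift-[] (suc k) = 0∷-≋[] (shift-[] k)

shift-+ₚ : ∀ k p q → shift k (p +ₚ q) ≡ shift k p +ₚ shift k q
shift-+ₚ zero    p q = refl
shift-+ₚ (suc k) p q = cong (0ℤ ∷_) (shift-+ₚ k p q)

shift-shift : ∀ j k p → shift j (shift k p) ≡ shift (j + k) p
shift-shift zero    k p = refl
shift-shift (suc j) k p = cong (0ℤ ∷_) (shift-shift j k p)

shift-*ₚˡ : ∀ k p q → shift k p *ₚ q ≋ shift k (p *ₚ q)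
shift-*ₚˡ zero    p q = ≋-refl
shift-*ₚˡ (suc k) p q = ≋-trans (0∷-*ₚ (shift k p) q) (∷-congˡ 0ℤ (shift-*ₚˡ k p q))

shift-*ₚʳ : ∀ k p q → p *ₚ shift k q ≋ shift k (p *ₚ q)
shift-*ₚʳ k p q = begin
  p *ₚ shift k q    ≈⟨ *ₚ-comm p (shift k q) ⟩
  shift k q *ₚ p    ≈⟨ shift-*ₚˡ k q p ⟩
  shift k (q *ₚ p)  ≈⟨ shift-cong k (*ₚ-comm q p) ⟩
  shift k (p *ₚ q)  ∎

-- Products of the polynomials 1 + t + ⋯ + tⁿ

geom-suc-*ₚ : ∀ n p → geom (suc n) *ₚ p ≋ p +ₚ (0ℤ ∷ geom n *ₚ p)
geom-suc-*ₚ n p = +ₚ-congʳ (0ℤ ∷ geom n *ₚ p) (·ₚ-identityˡ p)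

geom-*ₚ-geom-peel₁ : ∀ x y →
  geom (suc x) *ₚ geom (suc y) ≋ geom (suc (suc (x + y))) +ₚ shift 1 (geom x *ₚ geom y)
geom-*ₚ-geom-peel₁ zero y = begin
  geom 1 *ₚ geom (suc y)
    ≈⟨ geom-suc-*ₚ 0 (geom (suc y)) ⟩
  geom (suc y) +ₚ (0ℤ ∷ onePoly *ₚ geom (suc y))
    ≈⟨ +ₚ-congˡ (geom (suc y)) (∷-congˡ 0ℤ (*ₚ-identityˡ (geom (suc y)))) ⟩
  geom (suc y) +ₚ (0ℤ ∷ geom (suc y))
    ≈⟨ ∷-congˡ (1ℤ ℤ.+ 0ℤ) (+ₚ-comm (geom y) (geom (suc y))) ⟩
  geom (suc (suc y)) +ₚ (0ℤ ∷ geom y)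
    ≈⟨ +ₚ-congˡ (geom (suc (suc y))) (∷-congˡ 0ℤ (≋-sym (*ₚ-identityˡ (geom y)))) ⟩
  geom (suc (suc y)) +ₚ shift 1 (onePoly *ₚ geom y) ∎
geom-*ₚ-geom-peel₁ (suc x) y = begin
  geom (suc (suc x)) *ₚ geom (suc y)
    ≈⟨ geom-suc-*ₚ (suc x) (geom (suc y)) ⟩
  geom (suc y) +ₚ (0ℤ ∷ geom (suc x) *ₚ geom (suc y))
    ≈⟨ +ₚ-congˡ (geom (suc y)) (∷-congˡ 0ℤ (geom-*ₚ-geom-peel₁ x y)) ⟩
  geom (suc y) +ₚ (0ℤ ∷ geom (suc (suc (x + y))) +ₚ shift 1 Z)
    ≈⟨ ∷-congˡ (1ℤ ℤ.+ 0ℤ) (+ₚ.x∙yz≈y∙xz (geom y) (geom (suc (suc (x + y)))) (shift 1 Z)) ⟩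
  geom (suc (suc (suc (x + y)))) +ₚ (0ℤ ∷ geom y +ₚ shift 1 Z)
    ≈⟨ +ₚ-congˡ (geom (suc (suc (suc (x + y)))))
                (∷-congˡ 0ℤ (≋-sym (geom-suc-*ₚ x (geom y)))) ⟩
  geom (suc (suc (suc (x + y)))) +ₚ shift 1 (geom (suc x) *ₚ geom y) ∎
  where
  Z = geom x *ₚ geom y

geom-*ₚ-geom-peel : ∀ c x y →
  geom (suc (c + x)) *ₚ geom (suc (c + y))
    ≋ geom (suc (suc (c + x + y))) *ₚ geom c +ₚ shift (suc c) (geom x *ₚ geom y)
geom-*ₚ-geom-peel zero x y =
  ≋-trans (geom-*ₚ-geom-peel₁ x y)
          (+ₚ-congʳ (shift 1 (geom x *ₚ geom y)) (≋-sym (*ₚ-identityʳ (geom (suc (suc (x + y)))))))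
geom-*ₚ-geom-peel (suc c) x y = begin
  geom (suc (suc (c + x))) *ₚ geom (suc (suc (c + y)))
    ≈⟨ geom-*ₚ-geom-peel₁ (suc (c + x)) (suc (c + y)) ⟩
  geom (suc (suc (suc (c + x) + suc (c + y)))) +ₚ (0ℤ ∷ geom (suc (c + x)) *ₚ geom (suc (c + y)))
    ≈⟨ +ₚ-cong (≡⇒≋ (cong geom (degree c x y))) (∷-congˡ 0ℤ (geom-*ₚ-geom-peel c x y)) ⟩
  T +ₚ ((0ℤ ∷ A) +ₚ (0ℤ ∷ S))
    ≈⟨ ≋-sym (+ₚ-assoc T (0ℤ ∷ A) (0ℤ ∷ S)) ⟩
  (T +ₚ (0ℤ ∷ A)) +ₚ (0ℤ ∷ S)
    ≈⟨ +ₚ-congʳ (0ℤ ∷ S) (≋-sym (geom-*ₚ-geom-peel₁ (suc (suc (c + x + y))) c)) ⟩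
  geom (suc (suc (suc c + x + y))) *ₚ geom (suc c) +ₚ shift (suc (suc c)) (geom x *ₚ geom y) ∎
  where
  T = geom (suc (suc (suc (suc (c + x + y)) + c)))
  A = geom (suc (suc (c + x + y))) *ₚ geom c
  S = shift (suc c) (geom x *ₚ geom y)
  degree : ∀ c x y → suc (suc (suc (c + x) + suc (c + y))) ≡ suc (suc (suc (suc (c + x + y)) + c))
  degree = solve-∀

-- The cone spanned by the bases B_{d,i}

module +ℕ = CommutativeSemigroupProperties ℕₚ.+-commutativeSemigroup

module _ (i : ℕ) where

  -- Cone n p: p is a nonnegative integer combination of the polynomials
  -- t^j P_{n-1-2j,i}, i.e. of the members of B_{n-1,i} when n ≥ 1.
  data Cone (n : ℕ) : Poly → Set where
    ∅     : Cone n []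
    basis : ∀ j m → 2 * j + m ≡ n → Cone n (shift j (Pshift m i))
    _⊕_   : Cone n p → Cone n q → Cone n (p +ₚ q)
    resp  : p ≋ q → Cone n p → Cone n q

  Cone-cast : m ≡ n → Cone m p → Cone n p
  Cone-cast refl P = P

  Cone-scale : ∀ c → Cone n p → Cone n (+ c ·ₚ p)
  Cone-scale zero    P = resp (≋-sym (·ₚ-zeroˡ _)) ∅
  Cone-scale {p = p} (suc c) P = resp (≋-sym multiple) (P ⊕ Cone-scale c P)
    where
    multiple : + suc c ·ₚ p ≋ p +ₚ + c ·ₚ p
    multiple = ≋-trans (·ₚ-distribʳ-+ 1ℤ (+ c) p) (+ₚ-congʳ (+ c ·ₚ p) (·ₚ-identityˡ p))

  Cone-shift : ∀ s → Cone n p → Cone (2 * s + n) (shift s p)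
  Cone-shift s ∅ = resp (≋-sym (shift-[] s)) ∅
  Cone-shift s (basis j m e) =
    resp (≡⇒≋ (sym (shift-shift s j (Pshift m i))))
         (basis (s + j) m (trans (cong (_+ m) (ℕₚ.*-distribˡ-+ 2 s j))
                          (trans (ℕₚ.+-assoc (2 * s) (2 * j) m) (cong (_+_ (2 * s)) e))))
  Cone-shift s (_⊕_ {p} {q} P Q) =
    resp (≡⇒≋ (sym (shift-+ₚ s p q))) (Cone-shift s P ⊕ Cone-shift s Q)
  Cone-shift s (resp e P) = resp (shift-cong s e) (Cone-shift s P)

  module _ (generators-*ₚ : ∀ m m′ → Cone (m + m′) (Pshift m i *ₚ Pshift m′ i)) where

    basis-*ₚ-Cone : ∀ {a b} j m → 2 * j + m ≡ a → Cone b q →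
      Cone (a + b) (shift j (Pshift m i) *ₚ q)
    basis-*ₚ-Cone j m e ∅ = resp (≋-sym (*ₚ-zeroʳ (shift j (Pshift m i)))) ∅
    basis-*ₚ-Cone j m e (basis k m′ e′) =
      Cone-cast index (resp (≋-sym shifts) (Cone-shift (j + k) (generators-*ₚ m m′)))
      where
      A = Pshift m i
      B = Pshift m′ i
      shifts : shift j A *ₚ shift k B ≋ shift (j + k) (A *ₚ B)
      shifts = begin
        shift j A *ₚ shift k B     ≈⟨ shift-*ₚˡ j A (shift k B) ⟩
        shift j (A *ₚ shift k B)   ≈⟨ shift-cong j (shift-*ₚʳ k A B) ⟩
        shift j (shift k (A *ₚ B)) ≡⟨ shift-shift j k (A *ₚ B) ⟩
        shift (j + k) (A *ₚ B)     ∎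
      index : 2 * (j + k) + (m + m′) ≡ _
      index = trans (cong (_+ (m + m′)) (ℕₚ.*-distribˡ-+ 2 j k))
                    (trans (+ℕ.interchange (2 * j) (2 * k) m m′) (cong₂ _+_ e e′))
    basis-*ₚ-Cone j m e (_⊕_ {q} {q′} Q Q′) =
      resp (≋-sym (*ₚ-distribˡ-+ₚ (shift j (Pshift m i)) q q′))
           (basis-*ₚ-Cone j m e Q ⊕ basis-*ₚ-Cone j m e Q′)
    basis-*ₚ-Cone j m e (resp e′ Q) =
      resp (*ₚ-congˡ (shift j (Pshift m i)) e′) (basis-*ₚ-Cone j m e Q)

    Cone-*ₚ : ∀ {a b} → Cone a p → Cone b q → Cone (a + b) (p *ₚ q)
    Cone-*ₚ ∅             Q = ∅
    Cone-*ₚ (basis j m e) Q = basis-*ₚ-Cone j m e Q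
    Cone-*ₚ {q = q} (_⊕_ {p} {p′} P P′) Q =
      resp (≋-sym (*ₚ-distribʳ-+ₚ p p′ q)) (Cone-*ₚ P Q ⊕ Cone-*ₚ P′ Q)
    Cone-*ₚ {q = q} (resp e P) Q = resp (*ₚ-congʳ q e) (Cone-*ₚ P Q)

-- Products of two generators

overlap-split : ∀ {r r′ k} → r < k → r′ < k → k < r + r′ →
  ∃[ c ] ∃[ x ] ∃[ y ] suc (c + x) ≡ r × suc (c + y) ≡ r′ × suc (suc (c + x + y)) ≡ k
overlap-split {r} {r′} r<k r′<k k<r+r′ with ℕₚ.m≤n⇒∃[o]m+o≡n r′<k
... | x , refl with ℕₚ.m≤n⇒∃[o]m+o≡n k<r+r′
... | e , k+e≡r+r′ with ℕₚ.+-cancelʳ-≡ r′ (suc (suc (x + e))) r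
                          (trans (shuffle r′ x e) k+e≡r+r′)
  where
  shuffle : ∀ r′ x e → suc (suc (x + e)) + r′ ≡ suc (suc r′ + x) + e
  shuffle = solve-∀
... | refl with ℕₚ.m≤n⇒∃[o]m+o≡n r<k
... | y , r+y≡k with ℕₚ.+-cancelʳ-≡ (suc x) r′ (suc (suc (e + y)))
                       (trans (ℕₚ.+-suc r′ x) (trans (sym r+y≡k) (shuffle x e y)))
  where
  shuffle : ∀ x e y → suc (suc (suc (x + e))) + y ≡ suc (suc (e + y)) + suc x
  shuffle = solve-∀
... | refl = suc e , x , y , cong (suc ∘ suc) (ℕₚ.+-comm e x) , refl , shuffle x e y
  where
  shuffle : ∀ x e y → suc (suc (suc e + x + y)) ≡ suc (suc (suc (e + y))) + x
  shuffle = solve-∀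

module _ (i′ : ℕ) where

  private
    I = suc i′
    G = geom I

  Pshift-small : m ≤ I → Pshift m I ≋ geom m
  Pshift-small {zero}  _         = ≋-refl
  Pshift-small {suc n} (s≤s n≤i′) = begin
    Pshift (suc n) I
      ≡⟨ cong (λ q → G ^ₚ q *ₚ geom (suc n ∸ q * I)) (m<n⇒m/n≡0 (s≤s n≤i′)) ⟩
    onePoly *ₚ geom (suc n)
      ≈⟨ *ₚ-identityˡ (geom (suc n)) ⟩
    geom (suc n) ∎

  Pshift-+ : ∀ m → Pshift (I + m) I ≋ G *ₚ Pshift m I
  Pshift-+ zero = begin
    Pshift (I + 0) I   ≡⟨ cong (λ n → Pshift n I) (ℕₚ.+-identityʳ I) ⟩
    Pshift I I         ≈⟨ Pshift-small ℕₚ.≤-refl ⟩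
    G                  ≈⟨ ≋-sym (*ₚ-identityʳ G) ⟩
    G *ₚ onePoly       ∎
  Pshift-+ (suc n) = begin
    G ^ₚ ((i′ + suc n) / I) *ₚ geom (I + suc n ∸ (i′ + suc n) / I * I)
      ≡⟨ cong (λ q → G ^ₚ q *ₚ geom (I + suc n ∸ q * I)) quotient ⟩
    G ^ₚ suc (n / I) *ₚ geom (I + suc n ∸ (I + n / I * I))
      ≡⟨ cong (λ r → G ^ₚ suc (n / I) *ₚ geom r)
              (ℕₚ.[m+n]∸[m+o]≡n∸o I (suc n) (n / I * I)) ⟩
    (G *ₚ G ^ₚ (n / I)) *ₚ geom (suc n ∸ n / I * I)
      ≈⟨ *ₚ-assoc G (G ^ₚ (n / I)) _ ⟩
    G *ₚ Pshift (suc n) I ∎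
    where
    quotient : (i′ + suc n) / I ≡ suc (n / I)
    quotient = trans (cong (_/ I) (ℕₚ.+-suc i′ n))
                 (trans (m/n≡1+[m∸n]/n (ℕₚ.m≤m+n I n))
                        (cong (λ l → suc (l / I)) (ℕₚ.m+n∸m≡n I n)))

  Pshift-*+ : ∀ q {r} → r ≤ I → Pshift (q * I + r) I ≋ G ^ₚ q *ₚ geom r
  Pshift-*+ zero    {r} r≤I = ≋-trans (Pshift-small r≤I) (≋-sym (*ₚ-identityˡ (geom r)))
  Pshift-*+ (suc q) {r} r≤I = begin
    Pshift (I + q * I + r) I        ≡⟨ cong (λ n → Pshift n I) (ℕₚ.+-assoc I (q * I) r) ⟩
    Pshift (I + (q * I + r)) I      ≈⟨ Pshift-+ (q * I + r) ⟩
    G *ₚ Pshift (q * I + r) I       ≈⟨ *ₚ-congˡ G (Pshift-*+ q r≤I) ⟩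
    G *ₚ (G ^ₚ q *ₚ geom r)         ≈⟨ ≋-sym (*ₚ-assoc G (G ^ₚ q) (geom r)) ⟩
    G ^ₚ suc q *ₚ geom r            ∎

  Pshift-divMod : ∀ a → Pshift a I ≋ G ^ₚ (a / I) *ₚ geom (a % I)
  Pshift-divMod a =
    ≋-trans (≡⇒≋ (cong (λ n → Pshift n I) a≡q*I+r))
            (Pshift-*+ (a / I) (ℕₚ.<⇒≤ (m%n<n a I)))
    where
    a≡q*I+r : a ≡ a / I * I + a % I
    a≡q*I+r = trans (m≡m%n+[m/n]*n a I) (ℕₚ.+-comm (a % I) _)

  Cone-geom : n ≤ I → Cone I n (geom n)
  Cone-geom {n} n≤I = resp (Pshift-small n≤I) (basis 0 n refl)

  Cone-G*ₚ : Cone I n p → Cone I (I + n) (G *ₚ p)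
  Cone-G*ₚ ∅ = resp (≋-sym (*ₚ-zeroʳ G)) ∅
  Cone-G*ₚ (basis j m e) =
    resp shifted (basis j (I + m) (trans (+ℕ.x∙yz≈y∙xz (2 * j) I m) (cong (_+_ I) e)))
    where
    shifted : shift j (Pshift (I + m) I) ≋ G *ₚ shift j (Pshift m I)
    shifted = ≋-trans (shift-cong j (Pshift-+ m)) (≋-sym (shift-*ₚʳ j G (Pshift m I)))
  Cone-G*ₚ (_⊕_ {p} {q} P Q) =
    resp (≋-sym (*ₚ-distribˡ-+ₚ G p q)) (Cone-G*ₚ P ⊕ Cone-G*ₚ Q)
  Cone-G*ₚ (resp e P) = resp (*ₚ-congˡ G e) (Cone-G*ₚ P)

  Cone-G^*ₚ : ∀ q → Cone I n p → Cone I (q * I + n) (G ^ₚ q *ₚ p)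
  Cone-G^*ₚ {p = p} zero    P = resp (≋-sym (*ₚ-identityˡ p)) P
  Cone-G^*ₚ {n} {p} (suc q) P =
    Cone-cast I (sym (ℕₚ.+-assoc I (q * I) n))
      (resp (≋-sym (*ₚ-assoc G (G ^ₚ q) p)) (Cone-G*ₚ (Cone-G^*ₚ q P)))

  geom-*ₚ-geom-Cone-small : ∀ r r′ → r + r′ ≤ I → Cone I (r + r′) (geom r *ₚ geom r′)
  geom-*ₚ-geom-Cone-small zero r′ r′≤I =
    resp (≋-sym (*ₚ-identityˡ (geom r′))) (Cone-geom r′≤I)
  geom-*ₚ-geom-Cone-small (suc ρ) zero ρ+0<I =
    Cone-cast I (sym (ℕₚ.+-identityʳ (suc ρ)))
      (resp (≋-sym (*ₚ-identityʳ (geom (suc ρ)))) (Cone-geom (ℕₚ.m+n≤o⇒m≤o (suc ρ) ρ+0<I)))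
  geom-*ₚ-geom-Cone-small (suc ρ) (suc ρ′) r+r′≤I =
    Cone-cast I (cong suc (sym (ℕₚ.+-suc ρ ρ′)))
      (resp (≋-sym (geom-*ₚ-geom-peel₁ ρ ρ′))
        (Cone-geom 2+ρ+ρ′≤I ⊕ Cone-shift I 1 (geom-*ₚ-geom-Cone-small ρ ρ′ ρ+ρ′≤I)))
    where
    2+ρ+ρ′≤I : suc (suc (ρ + ρ′)) ≤ I
    2+ρ+ρ′≤I = subst (_≤ I) (cong suc (ℕₚ.+-suc ρ ρ′)) r+r′≤I
    ρ+ρ′≤I : ρ + ρ′ ≤ I
    ρ+ρ′≤I = ℕₚ.≤-trans (ℕₚ.n≤1+n _) (ℕₚ.≤-trans (ℕₚ.n≤1+n _) 2+ρ+ρ′≤I)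

  geom-*ₚ-geom-Cone-overlap : ∀ c x y → suc (suc (c + x + y)) ≡ I →
    Cone I (suc (c + x) + suc (c + y)) (geom (suc (c + x)) *ₚ geom (suc (c + y)))
  geom-*ₚ-geom-Cone-overlap c x y 2+c+x+y≡I =
    resp (≋-sym peel)
      (Cone-cast I index₁ (Cone-G*ₚ (Cone-geom (below-I c (ℕₚ.m≤m+n c (x + y)))))
       ⊕ Cone-cast I index₂
           (Cone-shift I (suc c)
             (geom-*ₚ-geom-Cone-small x y (below-I (x + y) (ℕₚ.m≤n+m (x + y) c)))))
    where
    below-I : ∀ z → z ≤ c + (x + y) → z ≤ I
    below-I z le = subst (z ≤_) 2+c+x+y≡I
      (ℕₚ.m≤n⇒m≤1+n (ℕₚ.m≤n⇒m≤1+n (subst (z ≤_) (sym (ℕₚ.+-assoc c x y)) le)))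
    peel : geom (suc (c + x)) *ₚ geom (suc (c + y))
             ≋ G *ₚ geom c +ₚ shift (suc c) (geom x *ₚ geom y)
    peel = subst (λ k → geom (suc (c + x)) *ₚ geom (suc (c + y))
                          ≋ geom k *ₚ geom c +ₚ shift (suc c) (geom x *ₚ geom y))
                 2+c+x+y≡I (geom-*ₚ-geom-peel c x y)
    index₁ : I + c ≡ suc (c + x) + suc (c + y)
    index₁ = trans (cong (_+ c) (sym 2+c+x+y≡I)) (solve c x y)
      where
      solve : ∀ c x y → suc (suc (c + x + y)) + c ≡ suc (c + x) + suc (c + y)
      solve = solve-∀
    index₂ : 2 * suc c + (x + y) ≡ suc (c + x) + suc (c + y)
    index₂ = solve c x y
      where
      solve : ∀ c x y → 2 * suc c + (x + y) ≡ suc (c + x) + suc (c + y)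
      solve = solve-∀

  geom-*ₚ-geom-Cone : ∀ {r r′} → r < I → r′ < I → Cone I (r + r′) (geom r *ₚ geom r′)
  geom-*ₚ-geom-Cone {r} {r′} r<I r′<I with r + r′ ≤? I
  ... | yes r+r′≤I = geom-*ₚ-geom-Cone-small r r′ r+r′≤I
  ... | no r+r′≰I with overlap-split r<I r′<I (ℕₚ.≰⇒> r+r′≰I)
  ...   | c , x , y , refl , refl , 2+c+x+y≡I = geom-*ₚ-geom-Cone-overlap c x y 2+c+x+y≡I

  Pshift-*ₚ-Pshift-Cone : ∀ a b → Cone I (a + b) (Pshift a I *ₚ Pshift b I)
  Pshift-*ₚ-Pshift-Cone a b =
    Cone-cast I index
      (resp (≋-sym rearrange)
        (Cone-G^*ₚ (a / I) (Cone-G^*ₚ (b / I) (geom-*ₚ-geom-Cone (m%n<n a I) (m%n<n b I)))))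
    where
    A = G ^ₚ (a / I)
    B = G ^ₚ (b / I)
    rearrange : Pshift a I *ₚ Pshift b I ≋ A *ₚ (B *ₚ (geom (a % I) *ₚ geom (b % I)))
    rearrange = begin
      Pshift a I *ₚ Pshift b I
        ≈⟨ *ₚ-cong (Pshift-divMod a) (Pshift-divMod b) ⟩
      (A *ₚ geom (a % I)) *ₚ (B *ₚ geom (b % I))
        ≈⟨ *ₚ.interchange A (geom (a % I)) B (geom (b % I)) ⟩
      (A *ₚ B) *ₚ (geom (a % I) *ₚ geom (b % I))
        ≈⟨ *ₚ-assoc A B _ ⟩
      A *ₚ (B *ₚ (geom (a % I) *ₚ geom (b % I))) ∎
    index : a / I * I + (b / I * I + (a % I + b % I)) ≡ a + b
    index = trans (regroup (a / I * I) (b / I * I) (a % I) (b % I))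
                  (sym (cong₂ _+_ (m≡m%n+[m/n]*n a I) (m≡m%n+[m/n]*n b I)))
      where
      regroup : ∀ u v w z → u + (v + (w + z)) ≡ (w + u) + (z + v)
      regroup = solve-∀

-- Coefficient vectors in the basis B_{d,i}

2*k≤1+d⇒k≤half : 2 * k ≤ suc d → k ≤ half d
2*k≤1+d⇒k≤half {k} {d} 2k≤1+d =
  subst (_≤ half d) (trans (cong (_/ 2) (ℕₚ.*-comm 2 k)) (m*n/n≡m k 2)) (/-monoˡ-≤ 2 2k≤1+d)

k≤half⇒2*k≤1+d : k ≤ half d → 2 * k ≤ suc d
k≤half⇒2*k≤1+d {k} {d} k≤half =
  ℕₚ.≤-trans (ℕₚ.*-monoʳ-≤ 2 k≤half)
             (subst (_≤ suc d) (ℕₚ.*-comm (half d) 2) (m/n*n≤m (suc d) 2))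

unitVec : (L j : ℕ) → Vec ℤ L
unitVec zero    j       = Vec.[]
unitVec (suc L) zero    = 1ℤ Vec.∷ Vec.replicate L 0ℤ
unitVec (suc L) (suc j) = 0ℤ Vec.∷ unitVec L j

All-replicate : ∀ {A : Set} {P : A → Set} {x} → P x → ∀ L → All P (Vec.replicate L x)
All-replicate px zero    = []
All-replicate px (suc L) = px ∷ All-replicate px L

unitVec-nonneg : ∀ L j → All (0ℤ ℤ.≤_) (unitVec L j)
unitVec-nonneg zero    j       = []
unitVec-nonneg (suc L) zero    = +≤+ z≤n ∷ All-replicate (+≤+ z≤n) L
unitVec-nonneg (suc L) (suc j) = +≤+ z≤n ∷ unitVec-nonneg L j

module _ (i d : ℕ) where

  private
    B : ℕ → Poly
    B k = shift k (Pshift (suc d ∸ 2 * k) i)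

  expand-replicate-0 : ∀ k L → expand d i k (Vec.replicate L 0ℤ) ≋ []
  expand-replicate-0 k zero    = ≋-refl
  expand-replicate-0 k (suc L) = +ₚ-cong (·ₚ-zeroˡ (B k)) (expand-replicate-0 (suc k) L)

  expand-zipWith-+ : ∀ {L} k (g g′ : Vec ℤ L) →
    expand d i k (Vec.zipWith ℤ._+_ g g′) ≋ expand d i k g +ₚ expand d i k g′
  expand-zipWith-+ k Vec.[] Vec.[] = ≋-refl
  expand-zipWith-+ k (a Vec.∷ g) (b Vec.∷ g′) = begin
    (a ℤ.+ b) ·ₚ B k +ₚ expand d i (suc k) (Vec.zipWith ℤ._+_ g g′)
      ≈⟨ +ₚ-cong (·ₚ-distribʳ-+ a b (B k)) (expand-zipWith-+ (suc k) g g′) ⟩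
    (a ·ₚ B k +ₚ b ·ₚ B k) +ₚ (expand d i (suc k) g +ₚ expand d i (suc k) g′)
      ≈⟨ +ₚ.interchange (a ·ₚ B k) (b ·ₚ B k) _ _ ⟩
    expand d i k (a Vec.∷ g) +ₚ expand d i k (b Vec.∷ g′) ∎

  expand-unitVec : ∀ k L j → j < L → expand d i k (unitVec L j) ≋ B (k + j)
  expand-unitVec k (suc L) zero    _ = begin
    1ℤ ·ₚ B k +ₚ expand d i (suc k) (Vec.replicate L 0ℤ)
      ≈⟨ +ₚ-cong (·ₚ-identityˡ (B k)) (expand-replicate-0 (suc k) L) ⟩
    B k +ₚ []   ≡⟨ +ₚ-identityʳ (B k) ⟩
    B k         ≡⟨ cong B (sym (ℕₚ.+-identityʳ k)) ⟩
    B (k + 0)   ∎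
  expand-unitVec k (suc L) (suc j) (s≤s j<L) = begin
    0ℤ ·ₚ B k +ₚ expand d i (suc k) (unitVec L j)
      ≈⟨ +ₚ-cong (·ₚ-zeroˡ (B k)) (expand-unitVec (suc k) L j j<L) ⟩
    B (suc k + j)  ≡⟨ cong B (sym (ℕₚ.+-suc k j)) ⟩
    B (k + suc j)  ∎

  expand-Cone : ∀ {L} k (g : Vec ℤ L) → k + L ≤ suc (half d) → All (0ℤ ℤ.≤_) g →
    Cone i (suc d) (expand d i k g)
  expand-Cone k Vec.[] _ [] = ∅
  expand-Cone {suc L} k (+ c Vec.∷ g) k+L<1+half (+≤+ _ ∷ g≥0) =
    Cone-scale i c (basis k (suc d ∸ 2 * k) (ℕₚ.m+[n∸m]≡n (k≤half⇒2*k≤1+d k≤half)))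
    ⊕ expand-Cone (suc k) g 1+k+L≤1+half g≥0
    where
    1+k+L≤1+half : suc k + L ≤ suc (half d)
    1+k+L≤1+half = subst (_≤ suc (half d)) (ℕₚ.+-suc k L) k+L<1+half
    k≤half : k ≤ half d
    k≤half = ℕₚ.m+n≤o⇒m≤o k (s≤s⁻¹ 1+k+L≤1+half)

  GNonneg⇒Cone : GNonneg d i p → Cone i (suc d) p
  GNonneg⇒Cone (g , g≥0 , combB≈ₚp) =
    resp (mk≋ {combB d i g} combB≈ₚp) (expand-Cone 0 g ℕₚ.≤-refl g≥0)

  Cone⇒GNonneg : Cone i (suc d) p → GNonneg d i p
  Cone⇒GNonneg ∅ =
    Vec.replicate (suc (half d)) 0ℤ , All-replicate (+≤+ z≤n) _ ,
    coeff≡ (expand-replicate-0 0 (suc (half d)))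
  Cone⇒GNonneg (basis j m 2j+m≡1+d) =
    unitVec _ j , unitVec-nonneg _ j ,
    coeff≡ (≋-trans (expand-unitVec 0 _ j (s≤s (2*k≤1+d⇒k≤half 2j≤1+d)))
                    (≡⇒≋ (cong (λ m → shift j (Pshift m i)) 1+d∸2j≡m)))
    where
    2j≤1+d : 2 * j ≤ suc d
    2j≤1+d = subst (2 * j ≤_) 2j+m≡1+d (ℕₚ.m≤m+n (2 * j) m)
    1+d∸2j≡m : suc d ∸ 2 * j ≡ m
    1+d∸2j≡m = trans (cong (_∸ 2 * j) (sym 2j+m≡1+d)) (ℕₚ.m+n∸m≡n (2 * j) m)
  Cone⇒GNonneg (_⊕_ {p} {q} P Q) with Cone⇒GNonneg P | Cone⇒GNonneg Q
  ... | g , g≥0 , g≈ₚp | g′ , g′≥0 , g′≈ₚq =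
    Vec.zipWith ℤ._+_ g g′ , All.zipWith ℤₚ.+-mono-≤ g≥0 g′≥0 ,
    coeff≡ (≋-trans (expand-zipWith-+ 0 g g′)
                    (+ₚ-cong (mk≋ {combB d i g} {p} g≈ₚp) (mk≋ {combB d i g′} {q} g′≈ₚq)))
  Cone⇒GNonneg (resp p≋q P) with Cone⇒GNonneg P
  ... | g , g≥0 , g≈ₚp = g , g≥0 , coeff≡ (≋-trans (mk≋ {combB d i g} g≈ₚp) p≋q)

-- The symmetry hypotheses are not needed: the coefficient vectors in the
-- hypotheses already express h and h′ in the bases.
proposition4p1 : (i m m′ : ℕ) → 0 < i →
    (h : Vec ℤ (suc (suc m))) → Symmetric h →
    (h′ : Vec ℤ (suc (suc m′))) → Symmetric h′ →
    GNonneg m i (toList h) → GNonneg m′ i (toList h′) →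
    GNonneg (m + m′ + 1) i (toList h *ₚ toList h′)
proposition4p1 i@(suc i′) m m′ _ h _ h′ _ g≥0 g′≥0 =
  Cone⇒GNonneg i (m + m′ + 1)
    (Cone-cast i index
      (Cone-*ₚ i (Pshift-*ₚ-Pshift-Cone i′)
        (GNonneg⇒Cone i m {toList h} g≥0) (GNonneg⇒Cone i m′ {toList h′} g′≥0)))
  where
  index : suc m + suc m′ ≡ suc (m + m′ + 1)
  index = cong suc (trans (ℕₚ.+-suc m m′) (ℕₚ.+-comm 1 (m + m′)))
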